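{- Let $\widetilde{\Sigma}$ be a $K$-stack call-return alphabet and $\mathcal{L}\subseteq\mathbb{NW}^\omega(\widetilde{\Sigma})$. The following are equivalent: (1) there is a Büchi MVPA $\mathcal{A}$ with $\mathcal{L}^\omega(\mathcal{A})=\mathcal{L}$; (2) there is a Büchi MNWA $\mathcal{B}$ with $\mathcal{L}^\omega(\mathcal{B})=\mathcal{L}$.
   Context: Let $\mathbb{N}_+=\{1,2,\dots\}$, $[K]=\{1,\dots,K\}$. A $K$-stack call-return alphabet is $\widetilde{\Sigma}=\langle\{(\Sigma_c^s,\Sigma_r^s)\}_{s\in[K]},\Sigma_{int}\rangle$ of pairwise disjoint finite sets; $\Sigma_c=\bigcup_s\Sigma_c^s$, $\Sigma_r=\bigcup_s\Sigma_r^s$, $\Sigma=\Sigma_c\cup\Sigma_r\cup\Sigma_{int}$. A Büchi MVPA over $\widetilde{\Sigma}$ is $\mathcal{A}=(Q,\Gamma,\delta,Q_I,F)$, finite $Q$, $Q_I,F\subseteq Q$, finite $\Gamma\ni\bot$, $\delta=\langle\delta_c,\delta_r,\delta_{int}\rangle$, $\delta_c\subseteq Q\times\Sigma_c\times(\Gamma\setminus\{\bot\})\times Q$, $\delta_r\subseteq Q\times\Sigma_r\times\Gamma\times Q$, $\delta_{int}\subseteq Q\times\Sigma_{int}\times Q$. A run on $w=a_1a_2\dots\in\Sigma^\omega$ is an infinite sequence of configurations $(q_i,\sigma_i^1,\dots,\sigma_i^K)$, $i\ge0$, stack contents in $(\Gamma\setminus\{\bot\})^*\bot$, $q_0\in Q_I$,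 $\sigma_0^s=\bot$, and for each $i\ge1$: a call $a_i\in\Sigma_c^s$ uses $(q_{i-1},a_i,A,q_i)\in\delta_c$ and pushes $A$ on stack $s$; a return $a_i\in\Sigma_r^s$ uses $(q_{i-1},a_i,A,q_i)\in\delta_r$ where either $A\ne\bot$ is popped from stack $s$, or $A=\bot$ and stack $s$ is and stays $\bot$; an internal action uses $(q_{i-1},a_i,q_i)\in\delta_{int}$; other stacks unchanged. Accepting if some state of $F$ occurs infinitely often among the $q_i$; $L^\omega(\mathcal{A})$ is the set of accepted strings. A string is $s$-well formed if generated by $A::=aAb\mid AA\mid\varepsilon\mid c$, $a\in\Sigma_c^s$, $b\in\Sigma_r^s$, $c\in\Sigma\setminus(\Sigma_c^s\cup\Sigma_r^s)$. An infinite nested word is $(\mathbb{N}_+,\lessdot,\mu,\lambda)$ with $\lessdot=\{(i,i+1)\}$, $\lambda:\mathbb{N}_+\to\Sigma$, $\mu=\bigcup_s\mu^s$, $(i,j)\in\mu^s$ iff $i<j$, $\lambda(i)\in\Sigma_c^s$, $\lambda(j)\in\Sigma_r^s$, $\lambda(i+1)\dots\lambda(j-1)$ $s$-well formed. $\mathbb{NW}^\omega(\widetilde{\Sigma})$ is their set; $\mathrm{nested}(w)$ is the unique one with label sequence $w\in\Sigma^\omega$, and $\mathcal{L}^\omega(\mathcal{A})=\{\mathrm{nested}(w)\mid w\in L^\omega(\mathcal{A})\}$. Write $\mu^{ -1}(j)=i$ for $(i,j)\in\mu$. A Büchi MNWA over $\widetilde{\Sigma}$ is $\mathcal{B}=(Q,\delta,Q_I,F)$,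 $\delta=\langle\delta_1,\delta_2\rangle$, $\delta_1\subseteq Q\times\Sigma\times Q$, $\delta_2\subseteq Q\times Q\times\Sigma_r\times Q$. A run on $(\mathbb{N}_+,\lessdot,\mu,\lambda)$ is $\rho:\mathbb{N}_+\to Q$ with $(q,\lambda(1),\rho(1))\in\delta_1$ for some $q\in Q_I$ and for $i\ge2$: $(\rho(\mu^{ -1}(i)),\rho(i-1),\lambda(i),\rho(i))\in\delta_2$ if $\lambda(i)\in\Sigma_r$ and $\mu^{ -1}(i)$ is defined, else $(\rho(i-1),\lambda(i),\rho(i))\in\delta_1$. Accepting if $\rho(i)\in F$ for infinitely many $i$; $\mathcal{L}^\omega(\mathcal{B})$ is the set of infinite nested words with an accepting run. -}

module Defs where

open import Data.Nat using (ℕ; zero; suc; _≤_; _<_; _∸_)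
open import Data.Fin using (Fin)
open import Data.Bool using (Bool; true)
open import Data.Maybe using (Maybe; just; nothing)
open import Data.List using (List; []; _∷_; _++_; [_])
open import Data.Product using (Σ; Σ-syntax; _×_; ∃)
open import Data.Sum using (_⊎_)
open import Relation.Nullary using (¬_)
open import Relation.Binary.PropositionalEquality using (_≡_; _≢_)
open import Function.Bundles using (_⇔_)

-- The finite alphabet Σ is Fin size; each letter is classified as a call
-- of stack s, a return of stack s, or an internal action.  This makes the
-- sets Σ_c^s, Σ_r^s, Σ_int pairwise disjoint finite sets covering Σ.

data Kind (K : ℕ) : Set where
  call : Fin K → Kind K
  ret  : Fin K → Kind K
  int  : Kind K

record Alphabet (K : ℕ) : Set where
  field
    size : ℕ
    kind : Fin size → Kind K

  Sym : Set
  Sym = Fin size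

open Alphabet public

module _ {K : ℕ} (Σ̃ : Alphabet K) where

  data WellFormed (s : Fin K) : List (Sym Σ̃) → Set where
    wf-nest  : ∀ {a b u} → kind Σ̃ a ≡ call s → kind Σ̃ b ≡ ret s →
               WellFormed s u → WellFormed s (a ∷ u ++ [ b ])
    wf-cat   : ∀ {u v} → WellFormed s u → WellFormed s v → WellFormed s (u ++ v)
    wf-eps   : WellFormed s []
    wf-other : ∀ {c} → kind Σ̃ c ≢ call s → kind Σ̃ c ≢ ret s →
               WellFormed s [ c ]

  window : (ℕ → Sym Σ̃) → ℕ → ℕ → List (Sym Σ̃)
  window f i zero    = []
  window f i (suc k) = f i ∷ window f (suc i) k

  -- Positions 1,2,3,… of the paper are represented
  -- by 0,1,2,… (position p ↦ p-1); the successor relation ⋖ is fixed, and the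
  -- matching relation μ is determined by the labelling, so a nested word is
  -- given by its labelling and μ is the derived relation below.
  -- (Thus nested(w) is the nested word with labelling w.)

  record NestedWord : Set where
    constructor nested
    field
      lab : ℕ → Sym Σ̃

  open NestedWord public

  Match : NestedWord → Fin K → ℕ → ℕ → Set
  Match nw s i j =
    i < j × kind Σ̃ (lab nw i) ≡ call s × kind Σ̃ (lab nw j) ≡ ret s ×
    WellFormed s (window (lab nw) (suc i) (j ∸ suc i))

  μ : NestedWord → ℕ → ℕ → Set
  μ nw i j = Σ[ s ∈ Fin K ] Match nw s i j

  InfOften : ∀ {Q : Set} → (Q → Bool) → (ℕ → Q) → Set
  InfOften F ρ = ∀ N → Σ[ i ∈ ℕ ] (N ≤ i × F (ρ i) ≡ true)

  -- States Fin nQ; stack alphabet Γ = Maybe (Fin nΓ) with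
  -- nothing = ⊥ (so Fin nΓ is Γ ∖ {⊥}); subsets are Bool-valued.
  -- δc is only consulted at call letters, δr at return letters, δi at
  -- internal letters.

  record MVPA : Set where
    field
      nQ   : ℕ
      nΓ   : ℕ
      δc   : Fin nQ → Sym Σ̃ → Fin nΓ → Fin nQ → Bool
      δr   : Fin nQ → Sym Σ̃ → Maybe (Fin nΓ) → Fin nQ → Bool
      δi   : Fin nQ → Sym Σ̃ → Fin nQ → Bool
      QI   : Fin nQ → Bool
      F    : Fin nQ → Bool

  module _ (A : MVPA) where
    open MVPA A

    -- configuration: a state and K stacks; the stack content γ₁…γₙ⊥ is
    -- represented by the list γ₁ ∷ … ∷ γₙ ∷ [] (⊥ implicit at the bottom)
    record Config : Set where
      constructor ⟨_,_⟩
      field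
        state : Fin nQ
        stk   : Fin K → List (Fin nΓ)
    open Config

    Others : Fin K → Config → Config → Set
    Others s c c' = ∀ t → t ≢ s → stk c' t ≡ stk c t

    data Step (c : Config) (a : Sym Σ̃) (c' : Config) : Set where
      step-call : ∀ s γ → kind Σ̃ a ≡ call s →
                  δc (state c) a γ (state c') ≡ true →
                  stk c' s ≡ γ ∷ stk c s → Others s c c' → Step c a c'
      step-pop  : ∀ s γ → kind Σ̃ a ≡ ret s →
                  δr (state c) a (just γ) (state c') ≡ true →
                  stk c s ≡ γ ∷ stk c' s → Others s c c' → Step c a c'
      step-bot  : ∀ s → kind Σ̃ a ≡ ret s →
                  δr (state c) a nothing (state c') ≡ true →
                  stk c s ≡ [] → stk c' s ≡ [] → Others s c c' → Step c a c'
      step-int  : kind Σ̃ a ≡ int →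
                  δi (state c) a (state c') ≡ true →
                  (∀ t → stk c' t ≡ stk c t) → Step c a c'

    -- run on w = a₁a₂…  (w i = a_{i+1}); config i = (q_i, σ_i)
    record MVPARun (w : ℕ → Sym Σ̃) : Set where
      field
        config : ℕ → Config
        init-q : QI (state (config 0)) ≡ true
        init-σ : ∀ s → stk (config 0) s ≡ []
        steps  : ∀ i → Step (config i) (w i) (config (suc i))

    AcceptsWord : (ℕ → Sym Σ̃) → Set
    AcceptsWord w = Σ[ r ∈ MVPARun w ]
      InfOften F (λ i → state (MVPARun.config r i))

    LangMVPA : NestedWord → Set
    LangMVPA nw = Σ[ w ∈ (ℕ → Sym Σ̃) ]
      (AcceptsWord w × (∀ i → lab nw i ≡ w i))

  -- Büchi MNWA.  δ₂ is only consulted at return letters.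

  record MNWA : Set where
    field
      nQ : ℕ
      δ₁ : Fin nQ → Sym Σ̃ → Fin nQ → Bool
      δ₂ : Fin nQ → Fin nQ → Sym Σ̃ → Fin nQ → Bool
      QI : Fin nQ → Bool
      F  : Fin nQ → Bool

  module _ (B : MNWA) where
    open MNWA B

    -- ρ i is the paper's ρ(i+1)
    IsMNWARun : NestedWord → (ℕ → Fin nQ) → Set
    IsMNWARun nw ρ =
      (Σ[ q ∈ Fin nQ ] (QI q ≡ true × δ₁ q (lab nw 0) (ρ 0) ≡ true)) ×
      (∀ i →
        (Σ[ j ∈ ℕ ] (μ nw j (suc i) ×
           δ₂ (ρ j) (ρ i) (lab nw (suc i)) (ρ (suc i)) ≡ true))
        ⊎
        ((¬ (Σ[ j ∈ ℕ ] μ nw j (suc i))) ×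
           δ₁ (ρ i) (lab nw (suc i)) (ρ (suc i)) ≡ true))

    LangMNWA : NestedWord → Set
    LangMNWA nw = Σ[ ρ ∈ (ℕ → Fin nQ) ] (IsMNWARun nw ρ × InfOften F ρ)

  SameLang : (NestedWord → Set) → (NestedWord → Set) → Set
  SameLang L₁ L₂ = ∀ nw → L₁ nw ⇔ L₂ nw

-- Both models consult, at a return, information attached to its matching
-- call: an MVPA pops the symbol that call pushed, an MNWA reads the state
-- reached right after it.  The list of still-open s-calls before position j
-- (computed from the labelling alone) is the s-stack of any run, each entry
-- replaced by the symbol pushed there: its top is the matching call of a
-- return at j, and it is empty exactly when that return is unmatched.  So
-- the accepting runs of either model are equivalent to sequences of local
-- moves that refer to matching calls directly.  An MVPA then becomes an
-- MNWA whose states also record the last pushed symbol, and an MNWA becomes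
-- an MVPA that pushes, at every call, the state it enters.

module Submission where

open import Defs
open import Data.Nat using (ℕ; zero; suc; _+_; _*_; _∸_; s≤s)
open import Data.Nat.Properties using (+-suc; +-identityʳ; m+n∸m≡n; m≤m+n; m+[n∸m]≡n; m≤n⇒m≤1+n)
open import Data.Nat.Tactic.RingSolver using (solve-∀)
open import Data.Fin as Fin using (Fin; combine; remQuot)
open import Data.Fin.Properties using (_≟_; remQuot-combine)
open import Data.List using (List; []; _∷_; _++_; [_]; length; drop; mapMaybe)
open import Data.List.Relation.Binary.Pointwise using (Pointwise; []; _∷_)
open import Data.Maybe using (Maybe; just; nothing)
open import Data.Maybe.Properties using (just-injective)
open import Data.Bool using (Bool; true; false; _∧_)
open import Data.Bool.Properties using (∧-conicalˡ; ∧-conicalʳ; ∧-identityʳ)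
open import Data.Product using (Σ-syntax; _×_; _,_; proj₁; proj₂)
open import Data.Sum using (_⊎_; inj₁; inj₂)
open import Relation.Nullary using (¬_; yes; no; does; contradiction)
open import Relation.Nullary.Decidable using (dec-true)
open import Relation.Binary.PropositionalEquality
  using (_≡_; _≢_; refl; sym; trans; cong; subst; subst₂; module ≡-Reasoning)
open import Function using (_∘_)
open import Function.Bundles using (_⇔_; mk⇔)
open import Function.Construct.Composition using (_⇔-∘_)
open import Function.Construct.Symmetry using (⇔-sym)

call-injective : ∀ {K} {s t : Fin K} → Kind.call s ≡ call t → s ≡ t
call-injective refl = refl

ret-injective : ∀ {K} {s t : Fin K} → Kind.ret s ≡ ret t → s ≡ t
ret-injective refl = refl

call≢ret : ∀ {K} {s t : Fin K} → Kind.call s ≢ ret t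
call≢ret ()

int≢ret : ∀ {K} {t : Fin K} → Kind.int ≢ ret t
int≢ret ()

int≢call : ∀ {K} {t : Fin K} → Kind.int ≢ call t
int≢call ()

pointwise-drop₁ : ∀ {A B : Set} {R : A → B → Set} {xs ys} →
                  Pointwise R xs ys → Pointwise R (drop 1 xs) (drop 1 ys)
pointwise-drop₁ []       = []
pointwise-drop₁ (_ ∷ rs) = rs

pointwise-[] : ∀ {A B : Set} {R : A → B → Set} {ys} → Pointwise R [] ys → ys ≡ []
pointwise-[] [] = refl

mapMaybe-∷-just : ∀ {A B : Set} {p : A → Maybe B} {x y} xs →
                  p x ≡ just y → mapMaybe p (x ∷ xs) ≡ y ∷ mapMaybe p xs
mapMaybe-∷-just _ eq rewrite eq = refl

finToMaybe : ∀ {n} → Fin (suc n) → Maybe (Fin n)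
finToMaybe Fin.zero    = nothing
finToMaybe (Fin.suc i) = just i

maybeToFin : ∀ {n} → Maybe (Fin n) → Fin (suc n)
maybeToFin nothing  = Fin.zero
maybeToFin (just i) = Fin.suc i

finToMaybe-maybeToFin : ∀ {n} (m : Maybe (Fin n)) → finToMaybe (maybeToFin m) ≡ m
finToMaybe-maybeToFin nothing  = refl
finToMaybe-maybeToFin (just i) = refl

_◂_ : {A : Set} → A → (ℕ → A) → ℕ → A
(x ◂ f) zero    = x
(x ◂ f) (suc i) = f i

module _ {K : ℕ} (Σ̃ : Alphabet K) where

  infOften-mono : ∀ {P Q : Set} {F : P → Bool} {G : Q → Bool} {ρ τ} →
                  (∀ i → F (ρ i) ≡ true → G (τ i) ≡ true) → InfOften Σ̃ F ρ → InfOften Σ̃ G τ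
  infOften-mono F⇒G inf N with inf N
  ... | i , N≤i , Fi = i , N≤i , F⇒G i Fi

  infOften-suc⁻ : ∀ {Q : Set} {F : Q → Bool} {ρ} → InfOften Σ̃ F (ρ ∘ suc) → InfOften Σ̃ F ρ
  infOften-suc⁻ inf N with inf N
  ... | i , N≤i , Fi = suc i , m≤n⇒m≤1+n N≤i , Fi

  infOften-suc⁺ : ∀ {Q : Set} {F : Q → Bool} {ρ} → InfOften Σ̃ F ρ → InfOften Σ̃ F (ρ ∘ suc)
  infOften-suc⁺ inf N with inf (suc N)
  ... | suc i , s≤s N≤i , Fi = i , N≤i , Fi

  pushPop : Fin K → ℕ → Kind K → List ℕ → List ℕ
  pushPop s n (call t) L with t ≟ s
  ... | yes _ = n ∷ L
  ... | no  _ = L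
  pushPop s n (ret t) L with t ≟ s
  ... | yes _ = drop 1 L
  ... | no  _ = L
  pushPop s n int L = L

  pushPop-call : ∀ s n L → pushPop s n (call s) L ≡ n ∷ L
  pushPop-call s n L with s ≟ s
  ... | yes _  = refl
  ... | no s≢s = contradiction refl s≢s

  pushPop-ret : ∀ s n L → pushPop s n (ret s) L ≡ drop 1 L
  pushPop-ret s n L with s ≟ s
  ... | yes _  = refl
  ... | no s≢s = contradiction refl s≢s

  pushPop-other : ∀ s n L k → k ≢ call s → k ≢ ret s → pushPop s n k L ≡ L
  pushPop-other s n L (call t) k≢call _ with t ≟ s
  ... | yes refl = contradiction refl k≢call
  ... | no  _    = refl
  pushPop-other s n L (ret t) _ k≢ret with t ≟ s
  ... | yes refl = contradiction refl k≢ret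
  ... | no  _    = refl
  pushPop-other s n L int _ _ = refl

  -- pending f s j: the positions of the s-calls before j that are still
  -- open, most recent first.  An unmatched return pops nothing.
  pending : (ℕ → Sym Σ̃) → Fin K → ℕ → List ℕ
  pending f s zero    = []
  pending f s (suc j) = pushPop s j (kind Σ̃ (f j)) (pending f s j)

  pending-call : ∀ f s j → kind Σ̃ (f j) ≡ call s → pending f s (suc j) ≡ j ∷ pending f s j
  pending-call f s j kc rewrite kc = pushPop-call s j _

  pending-ret : ∀ f s j → kind Σ̃ (f j) ≡ ret s → pending f s (suc j) ≡ drop 1 (pending f s j)
  pending-ret f s j kr rewrite kr = pushPop-ret s j _

  pending-int : ∀ f t j → kind Σ̃ (f j) ≡ int → pending f t (suc j) ≡ pending f t j
  pending-int f t j ki rewrite ki = refl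

  pending-other : ∀ f t j → kind Σ̃ (f j) ≢ call t → kind Σ̃ (f j) ≢ ret t →
                  pending f t (suc j) ≡ pending f t j
  pending-other f t j = pushPop-other t j _ (kind Σ̃ (f j))

  pending-call-other : ∀ f s t j → kind Σ̃ (f j) ≡ call s → t ≢ s → pending f t (suc j) ≡ pending f t j
  pending-call-other f s t j kc t≢s =
    pending-other f t j (λ e → t≢s (call-injective (trans (sym e) kc))) (λ e → call≢ret (trans (sym kc) e))

  pending-ret-other : ∀ f s t j → kind Σ̃ (f j) ≡ ret s → t ≢ s → pending f t (suc j) ≡ pending f t j
  pending-ret-other f s t j kr t≢s =
    pending-other f t j (λ e → call≢ret (trans (sym e) kr)) (λ e → t≢s (ret-injective (trans (sym e) kr)))

  replay : Fin K → ℕ → List (Sym Σ̃) → List ℕ → List ℕ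
  replay s n []      L = L
  replay s n (a ∷ u) L = replay s (suc n) u (pushPop s n (kind Σ̃ a) L)

  pending-+ : ∀ f s n k → pending f s (n + k) ≡ replay s n (window Σ̃ f n k) (pending f s n)
  pending-+ f s n zero    rewrite +-identityʳ n = refl
  pending-+ f s n (suc k) rewrite +-suc n k = pending-+ f s (suc n) k

  replay-++ : ∀ s u v n L → replay s n (u ++ v) L ≡ replay s (n + length u) v (replay s n u L)
  replay-++ s []      v n L rewrite +-identityʳ n = refl
  replay-++ s (a ∷ u) v n L rewrite +-suc n (length u) = replay-++ s u v (suc n) _

  replay-wellFormed : ∀ {s u} → WellFormed Σ̃ s u → ∀ n L → replay s n u L ≡ L
  replay-wellFormed {s} (wf-nest {a} {b} {u} ka kb wf) n L
    rewrite ka | pushPop-call s n L | replay-++ s u [ b ] (suc n) (n ∷ L)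
          | replay-wellFormed wf (suc n) (n ∷ L) | kb | pushPop-ret s (suc n + length u) (n ∷ L) = refl
  replay-wellFormed {s} (wf-cat {u} {v} wf₁ wf₂) n L
    rewrite replay-++ s u v n L | replay-wellFormed wf₁ n L = replay-wellFormed wf₂ _ L
  replay-wellFormed wf-eps n L = refl
  replay-wellFormed {s} (wf-other {c} nc nr) n L = pushPop-other s n L (kind Σ̃ c) nc nr

  pending-matched : ∀ nw s i j → Match Σ̃ nw s i j →
                    pending (lab nw) s j ≡ i ∷ pending (lab nw) s i
  pending-matched nw s i j (i<j , kc , _ , wf) = begin
    pending f s j                                               ≡⟨ cong (pending f s) (sym (m+[n∸m]≡n i<j)) ⟩
    pending f s (suc i + (j ∸ suc i))                           ≡⟨ pending-+ f s (suc i) (j ∸ suc i) ⟩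
    replay s (suc i) (window Σ̃ f (suc i) (j ∸ suc i)) (pending f s (suc i)) ≡⟨ replay-wellFormed wf (suc i) _ ⟩
    pending f s (suc i)                                         ≡⟨ pending-call f s i kc ⟩
    i ∷ pending f s i                                           ∎
    where open ≡-Reasoning
          f = lab nw

  window-+ : ∀ f n k l → window Σ̃ f n (k + l) ≡ window Σ̃ f n k ++ window Σ̃ f (n + k) l
  window-+ f n zero    l rewrite +-identityʳ n = refl
  window-+ f n (suc k) l rewrite +-suc n k = cong (f n ∷_) (window-+ f (suc n) k l)

  window-snoc : ∀ f n k → window Σ̃ f n (suc k) ≡ window Σ̃ f n k ++ [ f (n + k) ]
  window-snoc f n zero    rewrite +-identityʳ n = refl
  window-snoc f n (suc k) rewrite +-suc n k = cong (f n ∷_) (window-snoc f (suc n) k)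

  data OpenCalls (f : ℕ → Sym Σ̃) (s : Fin K) : ℕ → List ℕ → Set where
    none : ∀ {j} → OpenCalls f s j []
    open-call : ∀ {j i L} d → j ≡ suc i + d → kind Σ̃ (f i) ≡ call s →
                WellFormed Σ̃ s (window Σ̃ f (suc i) d) → OpenCalls f s i L → OpenCalls f s j (i ∷ L)

  openCalls-skip : ∀ {f s j L} → WellFormed Σ̃ s [ f j ] → OpenCalls f s j L → OpenCalls f s (suc j) L
  openCalls-skip wf none = none
  openCalls-skip {f} {s} wf (open-call {i = i} d refl kc wfd oc) =
    open-call (suc d) (sym (+-suc (suc i) d)) kc
      (subst (WellFormed Σ̃ s) (sym (window-snoc f (suc i) d)) (wf-cat wfd wf)) oc

  openCalls-close : ∀ {f s j i L} → kind Σ̃ (f j) ≡ ret s → OpenCalls f s j (i ∷ L) →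
                    OpenCalls f s (suc j) L
  openCalls-close kr (open-call d refl kc wfd none) = none
  openCalls-close {f} {s} kr (open-call {i = i} d refl kc wfd (open-call {i = i₂} d₂ refl kc₂ wfd₂ oc)) =
    open-call (d₂ + suc (suc d)) (offset i₂ d₂ d) kc₂ wf oc
    where
      offset : ∀ i₂ d₂ d → suc (suc (suc i₂ + d₂) + d) ≡ suc i₂ + (d₂ + suc (suc d))
      offset = solve-∀
      wf : WellFormed Σ̃ s (window Σ̃ f (suc i₂) (d₂ + suc (suc d)))
      wf rewrite window-+ f (suc i₂) d₂ (suc (suc d)) | window-snoc f (suc i) d =
        wf-cat wfd₂ (wf-nest kc kr wfd)

  wellFormed-single : ∀ {s c k} → kind Σ̃ c ≡ k → k ≢ call s → k ≢ ret s → WellFormed Σ̃ s [ c ]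
  wellFormed-single refl k≢call k≢ret = wf-other k≢call k≢ret

  openCalls-step : ∀ {f s j L} → OpenCalls f s j L →
                   OpenCalls f s (suc j) (pushPop s j (kind Σ̃ (f j)) L)
  openCalls-step {f} {s} {j} {L} oc with kind Σ̃ (f j) in eq
  ... | call t with t ≟ s
  ...   | yes refl = open-call 0 (cong suc (sym (+-identityʳ j))) eq wf-eps oc
  ...   | no t≢s   = openCalls-skip (wellFormed-single eq (λ e → t≢s (call-injective e)) λ ()) oc
  openCalls-step {f} {s} {j} {L} oc | ret t with t ≟ s
  openCalls-step {L = []}    oc | ret t | yes refl = none
  openCalls-step {L = _ ∷ _} oc | ret t | yes refl = openCalls-close eq oc
  ...   | no t≢s = openCalls-skip (wellFormed-single eq (λ ()) λ e → t≢s (ret-injective e)) oc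
  openCalls-step oc | int = openCalls-skip (wellFormed-single eq (λ ()) λ ()) oc

  openCalls-pending : ∀ f s j → OpenCalls f s j (pending f s j)
  openCalls-pending f s zero    = none
  openCalls-pending f s (suc j) = openCalls-step (openCalls-pending f s j)

  pending-top-matched : ∀ nw s i j L → kind Σ̃ (lab nw j) ≡ ret s →
                        pending (lab nw) s j ≡ i ∷ L → Match Σ̃ nw s i j
  pending-top-matched nw s i j L kr eq with subst (OpenCalls (lab nw) s j) eq (openCalls-pending (lab nw) s j)
  ... | open-call d refl kc wf _ =
    s≤s (m≤m+n i d) , kc , kr ,
    subst (λ n → WellFormed Σ̃ s (window Σ̃ (lab nw) (suc i) n)) (sym (m+n∸m≡n (suc i) d)) wf

  Unmatched : NestedWord Σ̃ → ℕ → Set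
  Unmatched nw j = ¬ (Σ[ k ∈ ℕ ] μ Σ̃ nw k j)

  unmatched-zero : ∀ nw → Unmatched nw 0
  unmatched-zero nw (k , s , () , _)

  unmatched-call : ∀ nw j s → kind Σ̃ (lab nw j) ≡ call s → Unmatched nw j
  unmatched-call nw j s kc (k , t , _ , _ , kr , _) = call≢ret (trans (sym kc) kr)

  unmatched-int : ∀ nw j → kind Σ̃ (lab nw j) ≡ int → Unmatched nw j
  unmatched-int nw j ki (k , t , _ , _ , kr , _) = int≢ret (trans (sym ki) kr)

  matched-pending : ∀ nw s k j → Match Σ̃ nw s k j →
                    pending (lab nw) s j ≡ k ∷ pending (lab nw) s (suc j)
  matched-pending nw s k j M@(_ , _ , kr , _) = begin
    pending f s j                ≡⟨ pending-matched nw s k j M ⟩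
    k ∷ pending f s k            ≡⟨ cong (λ L → k ∷ drop 1 L) (pending-matched nw s k j M) ⟨
    k ∷ drop 1 (pending f s j)   ≡⟨ cong (k ∷_) (pending-ret f s j kr) ⟨
    k ∷ pending f s (suc j)      ∎
    where open ≡-Reasoning
          f = lab nw

  unmatched⇒pending-[] : ∀ nw s j → kind Σ̃ (lab nw j) ≡ ret s → Unmatched nw j → pending (lab nw) s j ≡ []
  unmatched⇒pending-[] nw s j kr unmatched with pending (lab nw) s j in eq
  ... | []    = refl
  ... | k ∷ L = contradiction (k , s , pending-top-matched nw s k j L kr eq) unmatched

  pending-[]⇒unmatched : ∀ nw s j → kind Σ̃ (lab nw j) ≡ ret s → pending (lab nw) s j ≡ [] → Unmatched nw j
  pending-[]⇒unmatched nw s j kr eq (k , t , M@(_ , _ , kr′ , _))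
    with ret-injective (trans (sym kr) kr′)
  ... | refl with trans (sym eq) (pending-matched nw s k j M)
  ... | ()

  module _ (A : MVPA Σ̃) where
    open MVPA A
    open Config

    -- A run seen locally: the stack discipline is replaced by the matching
    -- relation, together with the symbol lbl k pushed at each call k.
    data Move (nw : NestedWord Σ̃) (σ : ℕ → Fin nQ) (lbl : ℕ → Maybe (Fin nΓ)) (j : ℕ) : Set where
      move-call : ∀ {s γ} → kind Σ̃ (lab nw j) ≡ call s → lbl j ≡ just γ →
                  δc (σ j) (lab nw j) γ (σ (suc j)) ≡ true → Move nw σ lbl j
      move-int  : kind Σ̃ (lab nw j) ≡ int →
                  δi (σ j) (lab nw j) (σ (suc j)) ≡ true → Move nw σ lbl j
      move-bot  : ∀ {s} → kind Σ̃ (lab nw j) ≡ ret s → Unmatched nw j →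
                  δr (σ j) (lab nw j) nothing (σ (suc j)) ≡ true → Move nw σ lbl j
      move-pop  : ∀ {k γ} → μ Σ̃ nw k j → lbl k ≡ just γ →
                  δr (σ j) (lab nw j) (just γ) (σ (suc j)) ≡ true → Move nw σ lbl j

    pushedBy : ∀ {c a c′} → Step Σ̃ A c a c′ → Maybe (Fin nΓ)
    pushedBy (step-call _ γ _ _ _ _) = just γ
    pushedBy (step-pop _ _ _ _ _ _)  = nothing
    pushedBy (step-bot _ _ _ _ _ _)  = nothing
    pushedBy (step-int _ _ _)        = nothing

    module _ {nw : NestedWord Σ̃} (r : MVPARun Σ̃ A (lab nw)) where
      open MVPARun r

      pushedAt : ℕ → Maybe (Fin nΓ)
      pushedAt j = pushedBy (steps j)

      PushedAt : Fin nΓ → ℕ → Set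
      PushedAt γ p = pushedAt p ≡ just γ

      stack-pending : ∀ j t → Pointwise PushedAt (stk (config j) t) (pending (lab nw) t j)
      stack-pending zero t rewrite init-σ t = []
      stack-pending (suc j) t with steps j in eq
      ... | step-call s γ kc _ e others with t ≟ s
      ...   | yes refl = subst₂ (Pointwise PushedAt) (sym e) (sym (pending-call (lab nw) s j kc))
                           (cong pushedBy eq ∷ stack-pending j s)
      ...   | no t≢s  = subst₂ (Pointwise PushedAt) (sym (others t t≢s))
                           (sym (pending-call-other (lab nw) s t j kc t≢s)) (stack-pending j t)
      stack-pending (suc j) t | step-pop s γ kr _ e others with t ≟ s
      ...   | yes refl = subst₂ (Pointwise PushedAt) (cong (drop 1) e) (sym (pending-ret (lab nw) s j kr))
                           (pointwise-drop₁ (stack-pending j s))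
      ...   | no t≢s  = subst₂ (Pointwise PushedAt) (sym (others t t≢s))
                           (sym (pending-ret-other (lab nw) s t j kr t≢s)) (stack-pending j t)
      stack-pending (suc j) t | step-bot s kr _ e e′ others with t ≟ s
      ...   | yes refl = subst₂ (Pointwise PushedAt) (trans (cong (drop 1) e) (sym e′))
                           (sym (pending-ret (lab nw) s j kr)) (pointwise-drop₁ (stack-pending j s))
      ...   | no t≢s  = subst₂ (Pointwise PushedAt) (sym (others t t≢s))
                           (sym (pending-ret-other (lab nw) s t j kr t≢s)) (stack-pending j t)
      stack-pending (suc j) t | step-int ki _ same =
        subst₂ (Pointwise PushedAt) (sym (same t))
          (sym (pending-int (lab nw) t j ki))
          (stack-pending j t)

      run-moves : ∀ j → Move nw (state ∘ config) pushedAt j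
      run-moves j with steps j in eq
      ... | step-call s γ kc dc _ _ = move-call kc (cong pushedBy eq) dc
      ... | step-int ki di _        = move-int ki di
      ... | step-bot s kr dr e _ _  = move-bot kr (pending-[]⇒unmatched nw s j kr
                                        (pointwise-[] (subst (λ X → Pointwise PushedAt X _) e (stack-pending j s)))) dr
      ... | step-pop s γ kr dr e _ with pending (lab nw) s j in eqP | subst (λ X → Pointwise PushedAt X _) e (stack-pending j s)
      ...   | k ∷ L | pushed ∷ _ = move-pop (s , pending-top-matched nw s k j L kr eqP) pushed dr

    module _ {nw : NestedWord Σ̃} {σ : ℕ → Fin nQ} {lbl : ℕ → Maybe (Fin nΓ)} where
      private f = lab nw

      configOf : ℕ → Config Σ̃ A
      configOf j = ⟨ σ j , (λ s → mapMaybe lbl (pending f s j)) ⟩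

      move-step : ∀ j → Move nw σ lbl j → Step Σ̃ A (configOf j) (f j) (configOf (suc j))
      move-step j (move-call {s} {γ} kc pushed dc) = step-call s γ kc dc push
        (λ t t≢s → cong (mapMaybe lbl) (pending-call-other f s t j kc t≢s))
        where push : mapMaybe lbl (pending f s (suc j)) ≡ γ ∷ mapMaybe lbl (pending f s j)
              push = trans (cong (mapMaybe lbl) (pending-call f s j kc)) (mapMaybe-∷-just (pending f s j) pushed)
      move-step j (move-int ki di) = step-int ki di (λ t → cong (mapMaybe lbl) (pending-int f t j ki))
      move-step j (move-bot {s} kr unmatched dr) = step-bot s kr dr
        (cong (mapMaybe lbl) empty)
        (cong (mapMaybe lbl) (trans (pending-ret f s j kr) (cong (drop 1) empty)))
        (λ t t≢s → cong (mapMaybe lbl) (pending-ret-other f s t j kr t≢s))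
        where empty : pending f s j ≡ []
              empty = unmatched⇒pending-[] nw s j kr unmatched
      move-step j (move-pop {k} {γ} (s , M@(_ , _ , kr , _)) pushed dr) = step-pop s γ kr dr pop
        (λ t t≢s → cong (mapMaybe lbl) (pending-ret-other f s t j kr t≢s))
        where pop : mapMaybe lbl (pending f s j) ≡ γ ∷ mapMaybe lbl (pending f s (suc j))
              pop = trans (cong (mapMaybe lbl) (matched-pending nw s k j M)) (mapMaybe-∷-just (pending f s (suc j)) pushed)

      moves-run : QI (σ 0) ≡ true → (∀ j → Move nw σ lbl j) → MVPARun Σ̃ A f
      moves-run qi moves = record
        { config = configOf ; init-q = qi ; init-σ = λ _ → refl ; steps = λ j → move-step j (moves j) }

    run-relabel : ∀ {w w′} → (∀ i → w′ i ≡ w i) → MVPARun Σ̃ A w → MVPARun Σ̃ A w′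
    run-relabel w′≡w r = record
      { config = config ; init-q = init-q ; init-σ = init-σ
      ; steps  = λ i → subst (λ a → Step Σ̃ A (config i) a (config (suc i))) (sym (w′≡w i)) (steps i) }
      where open MVPARun r

    AcceptingMoves : NestedWord Σ̃ → Set
    AcceptingMoves nw = Σ[ σ ∈ (ℕ → Fin nQ) ] Σ[ lbl ∈ (ℕ → Maybe (Fin nΓ)) ]
      (QI (σ 0) ≡ true × (∀ j → Move nw σ lbl j) × InfOften Σ̃ F σ)

    langMVPA⇔acceptingMoves : ∀ nw → LangMVPA Σ̃ A nw ⇔ AcceptingMoves nw
    langMVPA⇔acceptingMoves nw = mk⇔
      (λ (w , (r , inf) , lab≡w) → let r′ = run-relabel lab≡w r in
         state ∘ MVPARun.config r′ , pushedAt r′ , MVPARun.init-q r′ , run-moves r′ , inf)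
      (λ (σ , lbl , qi , moves , inf) → lab nw , (moves-run qi moves , inf) , λ _ → refl)

  module _ (B : MNWA Σ̃) where
    open MNWA B

    -- σ j is the state before position j, i.e. the paper's run with the
    -- initial state prepended.
    data NWMove (nw : NestedWord Σ̃) (σ : ℕ → Fin nQ) (j : ℕ) : Set where
      nw-matched   : ∀ {k} → μ Σ̃ nw k j →
                     δ₂ (σ (suc k)) (σ j) (lab nw j) (σ (suc j)) ≡ true → NWMove nw σ j
      nw-unmatched : Unmatched nw j →
                     δ₁ (σ j) (lab nw j) (σ (suc j)) ≡ true → NWMove nw σ j

    AcceptingNWMoves : NestedWord Σ̃ → Set
    AcceptingNWMoves nw = Σ[ σ ∈ (ℕ → Fin nQ) ]
      (QI (σ 0) ≡ true × (∀ j → NWMove nw σ j) × InfOften Σ̃ F σ)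

    langMNWA⇔acceptingNWMoves : ∀ nw → LangMNWA Σ̃ B nw ⇔ AcceptingNWMoves nw
    langMNWA⇔acceptingNWMoves nw = mk⇔ to from
      where
        to : LangMNWA Σ̃ B nw → AcceptingNWMoves nw
        to (ρ , ((q , qi , δ₁-first) , steps) , inf) = q ◂ ρ , qi , moves , infOften-suc⁻ {F = F} {ρ = q ◂ ρ} inf
          where
            moves : ∀ j → NWMove nw (q ◂ ρ) j
            moves zero = nw-unmatched (unmatched-zero nw) δ₁-first
            moves (suc i) with steps i
            ... | inj₁ (k , matched , δ₂-step) = nw-matched matched δ₂-step
            ... | inj₂ (unmatched , δ₁-step)   = nw-unmatched unmatched δ₁-step

        from : AcceptingNWMoves nw → LangMNWA Σ̃ B nw
        from (σ , qi , moves , inf) =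
          σ ∘ suc , ((σ 0 , qi , first (moves 0)) , λ i → step (moves (suc i))) , infOften-suc⁺ {F = F} {ρ = σ} inf
          where
            first : NWMove nw σ 0 → δ₁ (σ 0) (lab nw 0) (σ 1) ≡ true
            first (nw-matched (_ , () , _) _)
            first (nw-unmatched _ δ₁-first) = δ₁-first
            step : ∀ {i} → NWMove nw σ (suc i) →
                   (Σ[ k ∈ ℕ ] (μ Σ̃ nw k (suc i) × δ₂ (σ (suc k)) (σ (suc i)) (lab nw (suc i)) (σ (suc (suc i))) ≡ true))
                   ⊎ (Unmatched nw (suc i) × δ₁ (σ (suc i)) (lab nw (suc i)) (σ (suc (suc i))) ≡ true)
            step (nw-matched matched δ₂-step)   = inj₁ (_ , matched , δ₂-step)
            step (nw-unmatched unmatched δ₁-step) = inj₂ (unmatched , δ₁-step)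

  -- From MVPA to MNWA

  module ToMNWA (A : MVPA Σ̃) where
    open MVPA A

    -- A state of toMNWA A is a state of A together with the symbol pushed by
    -- the transition entering it, so that a return finds the symbol pushed
    -- by its matching call in the state right after that call.
    encode : Fin nQ → Maybe (Fin nΓ) → Fin (nQ * suc nΓ)
    encode q m = combine q (maybeToFin m)

    control : Fin (nQ * suc nΓ) → Fin nQ
    control x = proj₁ (remQuot {nQ} (suc nΓ) x)

    pushedSym : Fin (nQ * suc nΓ) → Maybe (Fin nΓ)
    pushedSym x = finToMaybe (proj₂ (remQuot {nQ} (suc nΓ) x))

    control-encode : ∀ q m → control (encode q m) ≡ q
    control-encode q m = cong proj₁ (remQuot-combine {nQ} {suc nΓ} q (maybeToFin m))

    pushedSym-encode : ∀ q m → pushedSym (encode q m) ≡ m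
    pushedSym-encode q m =
      trans (cong (finToMaybe ∘ proj₂) (remQuot-combine {nQ} {suc nΓ} q (maybeToFin m))) (finToMaybe-maybeToFin m)

    δ-unmatched : Kind K → Fin nQ → Sym Σ̃ → Maybe (Fin nΓ) → Fin nQ → Bool
    δ-unmatched (call _) q a (just γ) q′ = δc q a γ q′
    δ-unmatched (call _) q a nothing  q′ = false
    δ-unmatched (ret _)  q a _        q′ = δr q a nothing q′
    δ-unmatched int      q a _        q′ = δi q a q′

    δ-matched : Maybe (Fin nΓ) → Fin nQ → Sym Σ̃ → Fin nQ → Bool
    δ-matched nothing  q a q′ = false
    δ-matched (just γ) q a q′ = δr q a (just γ) q′

    toMNWA : MNWA Σ̃
    toMNWA = record
      { nQ = nQ * suc nΓ
      ; δ₁ = λ x a y → δ-unmatched (kind Σ̃ a) (control x) a (pushedSym y) (control y)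
      ; δ₂ = λ x y a z → δ-matched (pushedSym x) (control y) a (control z)
      ; QI = QI ∘ control
      ; F  = F ∘ control
      }

    nwMove⇒move : ∀ {nw τ j} → NWMove toMNWA nw τ j → Move A nw (control ∘ τ) (pushedSym ∘ τ ∘ suc) j
    nwMove⇒move {τ = τ} (nw-matched {k} matched δ₂-step) with pushedSym (τ (suc k)) in eq
    ... | just γ = move-pop matched eq δ₂-step
    nwMove⇒move {nw} {τ} {j} (nw-unmatched unmatched δ₁-step) =
      by-kind (kind Σ̃ (lab nw j)) refl (pushedSym (τ (suc j))) refl δ₁-step
      where
        by-kind : ∀ k → kind Σ̃ (lab nw j) ≡ k → ∀ m → pushedSym (τ (suc j)) ≡ m →
                  δ-unmatched k (control (τ j)) (lab nw j) m (control (τ (suc j))) ≡ true →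
                  Move A nw (control ∘ τ) (pushedSym ∘ τ ∘ suc) j
        by-kind (call s) ek (just γ) ep δc-step = move-call ek ep δc-step
        by-kind (ret s)  ek _        _  δr-step = move-bot ek unmatched δr-step
        by-kind int      ek _        _  δi-step = move-int ek δi-step

    move⇒nwMove : ∀ {nw σ lbl τ j} → (∀ i → control (τ i) ≡ σ i) → (∀ i → pushedSym (τ (suc i)) ≡ lbl i) →
                  Move A nw σ lbl j → NWMove toMNWA nw τ j
    move⇒nwMove {nw} {τ = τ} {j} ctl psh (move-call {s} kc pushed δc-step) =
      nw-unmatched (unmatched-call nw j s kc) δ₁-step
      where δ₁-step : MNWA.δ₁ toMNWA (τ j) (lab nw j) (τ (suc j)) ≡ true
            δ₁-step rewrite ctl j | ctl (suc j) | psh j | kc | pushed = δc-step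
    move⇒nwMove {nw} {τ = τ} {j} ctl psh (move-int ki δi-step) =
      nw-unmatched (unmatched-int nw j ki) δ₁-step
      where δ₁-step : MNWA.δ₁ toMNWA (τ j) (lab nw j) (τ (suc j)) ≡ true
            δ₁-step rewrite ctl j | ctl (suc j) | ki = δi-step
    move⇒nwMove {nw} {τ = τ} {j} ctl psh (move-bot kr unmatched δr-step) =
      nw-unmatched unmatched δ₁-step
      where δ₁-step : MNWA.δ₁ toMNWA (τ j) (lab nw j) (τ (suc j)) ≡ true
            δ₁-step rewrite ctl j | ctl (suc j) | kr = δr-step
    move⇒nwMove {nw} {τ = τ} {j} ctl psh (move-pop {k} matched pushed δr-step) =
      nw-matched matched δ₂-step
      where δ₂-step : MNWA.δ₂ toMNWA (τ (suc k)) (τ j) (lab nw j) (τ (suc j)) ≡ true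
            δ₂-step rewrite psh k | pushed | ctl j | ctl (suc j) = δr-step

    acceptingNWMoves-toMNWA⇔ : ∀ nw → AcceptingNWMoves toMNWA nw ⇔ AcceptingMoves A nw
    acceptingNWMoves-toMNWA⇔ nw = mk⇔
      (λ (τ , qi , moves , inf) → control ∘ τ , pushedSym ∘ τ ∘ suc , qi , (λ j → nwMove⇒move (moves j)) , inf)
      (λ (σ , lbl , qi , moves , inf) →
         let τ = λ i → encode (σ i) ((nothing ◂ lbl) i)
             control-τ = λ i → control-encode (σ i) ((nothing ◂ lbl) i)
         in τ , subst (λ q → QI q ≡ true) (sym (control-τ 0)) qi
              , (λ j → move⇒nwMove control-τ (λ i → pushedSym-encode (σ (suc i)) (lbl i)) (moves j))
              , infOften-mono {F = F} {G = F ∘ control} {τ = τ} (λ i → subst (λ q → F q ≡ true) (sym (control-τ i))) inf)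

    langMNWA-toMNWA : ∀ nw → LangMNWA Σ̃ toMNWA nw ⇔ LangMVPA Σ̃ A nw
    langMNWA-toMNWA nw =
      ⇔-sym (langMVPA⇔acceptingMoves A nw)
        ⇔-∘ (acceptingNWMoves-toMNWA⇔ nw ⇔-∘ langMNWA⇔acceptingNWMoves toMNWA nw)

  -- From MNWA to MVPA

  module ToMVPA (B : MNWA Σ̃) where
    open MNWA B

    -- toMVPA B pushes at each call the state it enters; a return pops the
    -- state reached right after its matching call, which is what δ₂ reads.
    δ-return : Fin nQ → Sym Σ̃ → Maybe (Fin nQ) → Fin nQ → Bool
    δ-return q a nothing  q′ = δ₁ q a q′
    δ-return q a (just p) q′ = δ₂ p q a q′

    toMVPA : MVPA Σ̃
    toMVPA = record
      { nQ = nQ ; nΓ = nQ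
      ; δc = λ q a p q′ → δ₁ q a q′ ∧ does (p ≟ q′)
      ; δr = δ-return ; δi = δ₁ ; QI = QI ; F = F
      }

    δc-pushes-target : ∀ {q a p q′} → MVPA.δc toMVPA q a p q′ ≡ true → p ≡ q′
    δc-pushes-target {q} {a} {p} {q′} δc-step with p ≟ q′
    ... | yes p≡q′ = p≡q′
    ... | no  _    = contradiction (∧-conicalʳ (δ₁ q a q′) false δc-step) λ ()

    δc⇒δ₁ : ∀ {q a p q′} → MVPA.δc toMVPA q a p q′ ≡ true → δ₁ q a q′ ≡ true
    δc⇒δ₁ {q} {a} {p} {q′} = ∧-conicalˡ (δ₁ q a q′) (does (p ≟ q′))

    nwMove⇒move : ∀ {nw σ j} → NWMove B nw σ j → Move toMVPA nw σ (just ∘ σ ∘ suc) j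
    nwMove⇒move (nw-matched matched δ₂-step) = move-pop matched refl δ₂-step
    nwMove⇒move {nw} {σ} {j} (nw-unmatched unmatched δ₁-step) = by-kind (kind Σ̃ (lab nw j)) refl
      where
        by-kind : ∀ k → kind Σ̃ (lab nw j) ≡ k → Move toMVPA nw σ (just ∘ σ ∘ suc) j
        by-kind (call s) kc = move-call kc refl
          (trans (cong (δ₁ (σ j) (lab nw j) (σ (suc j)) ∧_) (dec-true (σ (suc j) ≟ σ (suc j)) refl))
                 (trans (∧-identityʳ _) δ₁-step))
        by-kind (ret s)  kr = move-bot kr unmatched δ₁-step
        by-kind int      ki = move-int ki δ₁-step

    pushed-target : ∀ {nw σ lbl k s p} → Move toMVPA nw σ lbl k → kind Σ̃ (lab nw k) ≡ call s →
                    lbl k ≡ just p → p ≡ σ (suc k)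
    pushed-target (move-call _ pushed δc-step) _ eq =
      trans (just-injective (trans (sym eq) pushed)) (δc-pushes-target δc-step)
    pushed-target (move-int ki _)   kc _ = contradiction (trans (sym ki) kc) int≢call
    pushed-target (move-bot kr _ _) kc _ = contradiction (trans (sym kc) kr) call≢ret
    pushed-target (move-pop (_ , _ , _ , kr , _) _ _) kc _ = contradiction (trans (sym kc) kr) call≢ret

    moves⇒nwMoves : ∀ {nw σ lbl} → (∀ j → Move toMVPA nw σ lbl j) → ∀ j → NWMove B nw σ j
    moves⇒nwMoves {nw} moves j with moves j
    ... | move-call {s} {γ} kc _ δc-step = nw-unmatched (unmatched-call nw j s kc) (δc⇒δ₁ {p = γ} δc-step)
    ... | move-int ki δi-step        = nw-unmatched (unmatched-int nw j ki) δi-step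
    ... | move-bot _ unmatched δr-step = nw-unmatched unmatched δr-step
    ... | move-pop {k} matched@(_ , _ , kc , _) pushed δr-step =
      nw-matched matched (subst (λ p → δ₂ p _ _ _ ≡ true) (pushed-target (moves k) kc pushed) δr-step)

    acceptingMoves-toMVPA⇔ : ∀ nw → AcceptingMoves toMVPA nw ⇔ AcceptingNWMoves B nw
    acceptingMoves-toMVPA⇔ nw = mk⇔
      (λ (σ , _ , qi , moves , inf) → σ , qi , moves⇒nwMoves moves , inf)
      (λ (σ , qi , moves , inf) → σ , just ∘ σ ∘ suc , qi , (λ j → nwMove⇒move (moves j)) , inf)

    langMVPA-toMVPA : ∀ nw → LangMVPA Σ̃ toMVPA nw ⇔ LangMNWA Σ̃ B nw
    langMVPA-toMVPA nw =
      ⇔-sym (langMNWA⇔acceptingNWMoves B nw)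
        ⇔-∘ (acceptingMoves-toMVPA⇔ nw ⇔-∘ langMVPA⇔acceptingMoves toMVPA nw)

sameLang-trans : ∀ {K} (Σ̃ : Alphabet K) {L₁ L₂ L₃ : NestedWord Σ̃ → Set} →
                 SameLang Σ̃ L₁ L₂ → SameLang Σ̃ L₂ L₃ → SameLang Σ̃ L₁ L₃
sameLang-trans Σ̃ L₁≈L₂ L₂≈L₃ nw = L₂≈L₃ nw ⇔-∘ L₁≈L₂ nw

lemma6p5 : ∀ {K : ℕ} (Σ̃ : Alphabet K) (L : NestedWord Σ̃ → Set) →
    (Σ[ A ∈ MVPA Σ̃ ] SameLang Σ̃ (LangMVPA Σ̃ A) L)
      ⇔ (Σ[ B ∈ MNWA Σ̃ ] SameLang Σ̃ (LangMNWA Σ̃ B) L)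
lemma6p5 Σ̃ L = mk⇔
  (λ (A , A≈L) → ToMNWA.toMNWA Σ̃ A , sameLang-trans Σ̃ (ToMNWA.langMNWA-toMNWA Σ̃ A) A≈L)
  (λ (B , B≈L) → ToMVPA.toMVPA Σ̃ B , sameLang-trans Σ̃ (ToMVPA.langMVPA-toMVPA Σ̃ B) B≈L)
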